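{- Let $c$ be any function from nonempty strings to positive integers such that $z_{\mathrm{SSsr}}(T) \le c(T) \le z_{\mathrm{End}}(T)$ for every nonempty string $T$. Then for each edit type $\mathrm{edit} \in \{\mathrm{sub}, \mathrm{ins}, \mathrm{del}\}$, $\mathrm{AS}_{\mathrm{edit}}(c,n) = \Omega(n^{2/3})$.
   Context: Strings are over an alphabet $\Sigma$ that is not of bounded size (strings may use arbitrarily many distinct characters). $T[i..j]$ is the substring from position $i$ to $j$. An LZ-style factorization of $T$ is $T = f_1\cdots f_z$ with nonempty phrases, each either a single fresh character (not occurring earlier in $T$) or a copy of a substring occurring earlier. The overlapping LZSS factorization is the greedy one: each phrase $f_k$, starting at position $s=|f_1\cdots f_{k-1}|+1$, is a fresh character if $T[s]$ does not occur in $T[1..s-1]$, and otherwise is the longest prefix of $T[s..n]$ that has an occurrence starting at some position $< s$ (possibly overlapping $f_k$); $z_{\mathrm{SSsr}}(T)$ is its number of phrases. An LZ-End factorization is an LZ-style factorization in which each copied phrase $f_k$ has an occurrence $T[i..j]$ with $j \le |f_1\cdots f_{k-1}|$ and $j = |f_1\cdots f_h|$ for some $h<k$ (i.e., the occurrence ends at the end of an earlier phrase). The greedy LZ-End factorization takes each copied phrase $f_k$ as the longest prefix of the remaining suffix $T[|f_1\cdots f_{k-1}|+1..n]$ that is a suffix of $f_1\cdots f_h$ for some $h<k$ (a fresh single character otherwise); $z_{\mathrm{End}}(T)$ is its number of phrases. For a measure $c$, $\mathrm{AS}_{\mathrm{edit}}(c,n) = \max\{c(T')-c(T)\}$ over all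 strings $T$ of length $n$ and all $T'$ obtained from $T$ by a single edit of the given type (substitution, insertion or deletion of one character). $\Omega(n^{2/3})$ means there is a constant $C>0$ with $\mathrm{AS}_{\mathrm{edit}}(c,n) \ge C n^{2/3}$ for infinitely many $n$. -}

module Defs where

open import Data.Nat using (ℕ; zero; suc; _+_; _∸_; _⊔_; _≤ᵇ_; _<_; _≤_; _≟_)
open import Data.Bool using (Bool; true; false; if_then_else_; _∧_; _∨_)
open import Data.List using (List; []; _∷_; _++_; length; take; drop)
open import Data.Bool.ListAction using (any)
open import Data.List.Properties using (≡-dec)
open import Relation.Nullary.Decidable using (⌊_⌋)

-- Strings over an unbounded alphabet: characters are natural numbers.
-- Positions are 0-indexed; position s means the suffix drop s T.
Str : Set
Str = List ℕ

_==_ : Str → Str → Bool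
u == v = ⌊ ≡-dec _≟_ u v ⌋

maxSat : ℕ → (ℕ → Bool) → ℕ
maxSat zero    p = 0
maxSat (suc m) p = if p (suc m) then suc m else maxSat m p

anyBelow : ℕ → (ℕ → Bool) → Bool
anyBelow zero    p = false
anyBelow (suc s) p = p s ∨ anyBelow s p

-- length of the longest prefix of T[s..] occurring at some start i < s
-- (overlaps allowed); 0 if T[s] does not occur earlier
ssLen : Str → ℕ → ℕ
ssLen T s = maxSat (length T ∸ s)
  (λ ℓ → anyBelow s (λ i → take ℓ (drop i T) == take ℓ (drop s T)))

-- number of phrases of the greedy factorization of T[s..], with fuel;
-- a phrase is fresh (length 1) when ssLen = 0, else of length ssLen
ssCount : Str → ℕ → ℕ → ℕ
ssCount T zero       s = 0
ssCount T (suc fuel) s =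
  if length T ≤ᵇ s then 0
  else suc (ssCount T fuel (s + (1 ⊔ ssLen T s)))

-- every phrase has length ≥ 1, so fuel = length T suffices
zSS : Str → ℕ
zSS T = ssCount T (length T) 0

-- ends : the end positions |f₁⋯f_h| of all earlier phrases (all ≤ s).
-- length of the longest prefix of T[s..] that is a suffix of T[0..e)
-- for some earlier phrase end e; 0 if none (then fresh character)
endLen : Str → List ℕ → ℕ → ℕ
endLen T ends s = maxSat (length T ∸ s)
  (λ ℓ → any (λ e → (ℓ ≤ᵇ e) ∧ (take ℓ (drop (e ∸ ℓ) T) == take ℓ (drop s T))) ends)

endCount : Str → ℕ → ℕ → List ℕ → ℕ
endCount T zero       s ends = 0
endCount T (suc fuel) s ends =
  if length T ≤ᵇ s then 0
  else suc (endCount T fuel (s + (1 ⊔ endLen T ends s)) ((s + (1 ⊔ endLen T ends s)) ∷ ends))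

zEnd : Str → ℕ
zEnd T = endCount T (length T) 0 []

data EditType : Set where
  sub ins del : EditType

data Edit : EditType → Str → Str → Set where
  esub : ∀ {T} (i : ℕ) (a : ℕ) → i < length T → Edit sub T (take i T ++ a ∷ drop (suc i) T)
  eins : ∀ {T} (i : ℕ) (a : ℕ) → i ≤ length T → Edit ins T (take i T ++ a ∷ drop i T)
  edel : ∀ {T} (i : ℕ) → i < length T → Edit del T (take i T ++ drop (suc i) T)

-- Take the text 1 2 ⋯ 3D followed, for every 1 ≤ a ≤ D < d ≤ 2D, by a fresh separator and the
-- run a (a+1) ⋯ (a+d−1); its length n is O(D³). Greedy LZ-End spends 3D fresh phrases on the
-- prefix, which makes every prefix position a phrase end, and then two phrases per run: the
-- separator and a copy ending at the prefix phrase a+d−1. So z_End ≤ 3D + 2D². Every run contains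
-- the factor D (D+1), which a substitution, insertion or deletion at position D destroys. After the
-- edit no run occurs earlier in the text (a later run is never a subrun of an earlier one), so with
-- the fresh separators each run forces three LZSS phrases: z_SS ≥ 3D².
-- Hence c grows by at least D(D − 3), which is Ω(n^{2/3}) once D ≥ 6.
module Submission where

open import Defs
open import Data.Bool using (Bool; true; false; T; _∧_)
open import Data.Bool.Properties using (T-≡; T-∧)
open import Data.Bool.ListAction using (any)
open import Data.Empty using (⊥-elim)
open import Data.List using (List; []; _∷_; [_]; _++_; length; take; drop)
open import Data.List.Properties
  using (≡-dec; take-drop; take-take; drop-drop; length-++; ++-assoc; ++-identityʳ; ∷-injectiveˡ; ∷-injectiveʳ)
open import Data.List.Membership.Propositional using (_∈_; _∉_; find; lose)
open import Data.List.Membership.Propositional.Properties using (∈-++⁻)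
open import Data.List.Relation.Unary.All as All using (All; []; _∷_)
open import Data.List.Relation.Unary.All.Properties using (++⁺)
open import Data.List.Relation.Unary.AllPairs using (AllPairs; []; _∷_)
import Data.List.Relation.Unary.AllPairs.Properties as AllPairs
open import Data.List.Relation.Unary.Any using (here; there)
open import Data.List.Relation.Unary.Any.Properties using (any⁺; any⁻)
open import Data.Nat
  using (ℕ; zero; suc; _+_; _*_; _∸_; _^_; _⊔_; _⊓_; _≤_; _<_; _≤ᵇ_; _≤?_; _≟_; z≤n; s≤s)
open import Data.Nat.Properties
open import Data.Nat.Tactic.RingSolver using (solve-∀)
open import Data.Product using (_×_; _,_; proj₁; proj₂; ∃-syntax; uncurry)
open import Data.Sum using (_⊎_; inj₁; inj₂; [_,_]′)
open import Data.Unit using (⊤; tt)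
open import Function using (_∘_; Equivalence)
open import Relation.Nullary using (¬_; yes; no)
open import Relation.Nullary.Decidable using (dec-false; dec-true; toWitness; fromWitness)
open import Relation.Binary.PropositionalEquality hiding ([_])

T⇒≡true : ∀ {b} → T b → b ≡ true
T⇒≡true = Equivalence.to T-≡

≡true⇒T : ∀ {b} → b ≡ true → T b
≡true⇒T = Equivalence.from T-≡

==-sound : ∀ {u v} → T (u == v) → u ≡ v
==-sound {u} {v} = toWitness {a? = ≡-dec _≟_ u v}

==-complete : ∀ {u v} → u ≡ v → T (u == v)
==-complete {u} {v} = fromWitness {a? = ≡-dec _≟_ u v}

anyBelow-sound : ∀ s p → T (anyBelow s p) → ∃[ i ] (i < s × T (p i))
anyBelow-sound (suc s) p h with p s in eq
... | true  = s , ≤-refl , ≡true⇒T eq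
... | false with anyBelow-sound s p h
...   | i , i<s , pi = i , m≤n⇒m≤1+n i<s , pi

maxSat-sound : ∀ m p {ℓ} → maxSat m p ≡ suc ℓ → T (p (suc ℓ))
maxSat-sound (suc m) p eq with p (suc m) in q
... | true  = subst (T ∘ p) eq (≡true⇒T q)
... | false = maxSat-sound m p eq

maxSat-≡ : ∀ m p {ℓ} → ℓ ≤ m → (ℓ ≡ 0 ⊎ T (p ℓ)) →
  (∀ {j} → ℓ < j → j ≤ m → ¬ T (p j)) → maxSat m p ≡ ℓ
maxSat-≡ zero    p z≤n _ _ = refl
maxSat-≡ (suc m) p {ℓ} ℓ≤ sat above with ℓ ≟ suc m
... | yes refl with sat
...   | inj₂ pℓ rewrite T⇒≡true pℓ = refl
maxSat-≡ (suc m) p {ℓ} ℓ≤ sat above | no ℓ≢ with p (suc m) in q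
... | true  = ⊥-elim (above (≤∧≢⇒< ℓ≤ ℓ≢) ≤-refl (≡true⇒T q))
... | false = maxSat-≡ m p (≤-pred (≤∧≢⇒< ℓ≤ ℓ≢)) sat
                (λ ℓ<j j≤m → above ℓ<j (m≤n⇒m≤1+n j≤m))

take-length-++ : ∀ (P Q : Str) → take (length P) (P ++ Q) ≡ P
take-length-++ []      Q = refl
take-length-++ (x ∷ P) Q = cong (x ∷_) (take-length-++ P Q)

drop-length-++ : ∀ (P Q : Str) → drop (length P) (P ++ Q) ≡ Q
drop-length-++ []      Q = refl
drop-length-++ (x ∷ P) Q = drop-length-++ P Q

drop-suc-length-++ : ∀ (P : Str) {x W} → drop (suc (length P)) (P ++ x ∷ W) ≡ W
drop-suc-length-++ []      = refl
drop-suc-length-++ (y ∷ P) = drop-suc-length-++ P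

∈-take : ∀ {x} k (Y : Str) → x ∈ take k Y → x ∈ Y
∈-take (suc k) (y ∷ Y) (here x≡y) = here x≡y
∈-take (suc k) (y ∷ Y) (there x∈) = there (∈-take k Y x∈)

∈-drop : ∀ {x} k (Y : Str) → x ∈ drop k Y → x ∈ Y
∈-drop zero    Y       x∈ = x∈
∈-drop (suc k) (y ∷ Y) x∈ = there (∈-drop k Y x∈)

take-drop-take : ∀ o m {ℓ} (X : Str) → o + m ≤ ℓ →
  take m (drop o (take ℓ X)) ≡ take m (drop o X)
take-drop-take o m {ℓ} X o+m≤ℓ = begin
  take m (drop o (take ℓ X))        ≡⟨ take-drop m o (take ℓ X) ⟩
  drop o (take (o + m) (take ℓ X))  ≡⟨ cong (drop o) (take-take (o + m) ℓ X) ⟩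
  drop o (take ((o + m) ⊓ ℓ) X)     ≡⟨ cong (λ k → drop o (take k X)) (m≤n⇒m⊓n≡m o+m≤ℓ) ⟩
  drop o (take (o + m) X)           ≡⟨ take-drop m o X ⟨
  take m (drop o X)                 ∎
  where open ≡-Reasoning

factor-shift : ∀ (X : Str) {i s ℓ} o m → o + m ≤ ℓ →
  take ℓ (drop i X) ≡ take ℓ (drop s X) → take m (drop (o + i) X) ≡ take m (drop (o + s) X)
factor-shift X {i} {s} {ℓ} o m o+m≤ℓ eq = begin
  take m (drop (o + i) X)             ≡⟨ cong (take m) (shift i) ⟩
  take m (drop o (drop i X))          ≡⟨ take-drop-take o m (drop i X) o+m≤ℓ ⟨
  take m (drop o (take ℓ (drop i X))) ≡⟨ cong (take m ∘ drop o) eq ⟩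
  take m (drop o (take ℓ (drop s X))) ≡⟨ take-drop-take o m (drop s X) o+m≤ℓ ⟩
  take m (drop o (drop s X))          ≡⟨ cong (take m) (shift s) ⟨
  take m (drop (o + s) X)             ∎
  where
  open ≡-Reasoning
  shift : ∀ j → drop (o + j) X ≡ drop o (drop j X)
  shift j = trans (cong (λ k → drop k X) (+-comm o j)) (sym (drop-drop j o X))

record Occ (w Y : Str) (i : ℕ) : Set where
  constructor occurs
  field window : take (length w) (drop i Y) ≡ w

occ-∈ : ∀ {x w Y i} → x ∈ w → Occ w Y i → x ∈ Y
occ-∈ {w = w} {Y} {i} x∈w (occurs window) =
  ∈-drop i Y (∈-take (length w) (drop i Y) (subst (_ ∈_) (sym window) x∈w))

occ-++-sep : ∀ (A : Str) {C w s i} → s ∉ w → Occ w (A ++ s ∷ C) i →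
  Occ w A i ⊎ (length A < i × Occ w C (i ∸ suc (length A)))
occ-++-sep A       {w = []}                s∉w _           = inj₁ (occurs refl)
occ-++-sep []      {w = y ∷ w} {i = zero}  s∉w (occurs eq) = ⊥-elim (s∉w (here (∷-injectiveˡ eq)))
occ-++-sep (x ∷ A) {w = y ∷ w} {i = zero}  s∉w (occurs eq)
  with occ-++-sep A {i = 0} (s∉w ∘ there) (occurs (∷-injectiveʳ eq))
... | inj₁ (occurs eq') = inj₁ (occurs (cong₂ _∷_ (∷-injectiveˡ eq) eq'))
occ-++-sep []      {w = y ∷ w} {i = suc i} s∉w (occurs eq) = inj₂ (s≤s z≤n , occurs eq)
occ-++-sep (x ∷ A) {w = y ∷ w} {i = suc i} s∉w (occurs eq) with occ-++-sep A s∉w (occurs eq)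
... | inj₁ (occurs eq')   = inj₁ (occurs eq')
... | inj₂ (A<i , occ')   = inj₂ (s≤s A<i , occ')

NoEarlierOcc : Str → ℕ → ℕ → Set
NoEarlierOcc X k ℓ = ∀ i → i < k → take ℓ (drop i X) ≢ take ℓ (drop k X)

Fresh : Str → ℕ → Set
Fresh X k = NoEarlierOcc X k 1

fresh⇒noEarlierOcc : ∀ X {k ℓ} o → o < ℓ → Fresh X (o + k) → NoEarlierOcc X k ℓ
fresh⇒noEarlierOcc X {k} {ℓ} o o<ℓ fresh i i<k eq =
  fresh (o + i) (+-monoʳ-< o i<k) (factor-shift X o 1 (subst (_≤ ℓ) (+-comm 1 o) o<ℓ) eq)

head-drop-++ : ∀ (P Q : Str) {i} → i < length P → ∃[ y ] (y ∈ P × take 1 (drop i (P ++ Q)) ≡ [ y ])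
head-drop-++ (y ∷ P) Q {zero}  _         = y , here refl , refl
head-drop-++ (y ∷ P) Q {suc i} (s≤s i<P) with head-drop-++ P Q i<P
... | z , z∈P , eq = z , there z∈P , eq

fresh-++ : ∀ (P : Str) {x Q} → x ∉ P → Fresh (P ++ x ∷ Q) (length P)
fresh-++ P {x} {Q} x∉P i i<P eq with head-drop-++ P (x ∷ Q) i<P
... | y , y∈P , hd rewrite drop-length-++ P (x ∷ Q) =
  x∉P (subst (_∈ P) (∷-injectiveˡ (trans (sym hd) eq)) y∈P)

-- Between consecutive positions k < k' the factor X[k..k'] has no earlier occurrence, so an
-- LZSS phrase starting at or before k ends before k': every chain position forces a phrase.
BreakChain : Str → List ℕ → Set
BreakChain X []            = ⊤
BreakChain X (k ∷ [])      = k < length X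
BreakChain X (k ∷ k' ∷ ks) = k < k' × NoEarlierOcc X k (suc (k' ∸ k)) × BreakChain X (k' ∷ ks)

breakChain-head< : ∀ X k ks → BreakChain X (k ∷ ks) → k < length X
breakChain-head< X k []        k<X            = k<X
breakChain-head< X k (k' ∷ ks) (k<k' , _ , ch) = <-trans k<k' (breakChain-head< X k' ks ch)

ssNext-≤ : ∀ X {s k k'} → s ≤ k → k < k' → NoEarlierOcc X k (suc (k' ∸ k)) →
  s + (1 ⊔ ssLen X s) ≤ k'
ssNext-≤ X {s} {k} {k'} s≤k k<k' new with ssLen X s in eq
... | zero  = ≤-trans (+-monoˡ-≤ 1 s≤k) (subst (_≤ k') (+-comm 1 k) k<k')
... | suc ℓ with s + suc ℓ ≤? k'
...   | yes fits = fits
...   | no long with anyBelow-sound s _ (maxSat-sound (length X ∸ s) _ eq)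
...     | i , i<s , match = ⊥-elim (
  new (o + i) (subst (o + i <_) o+s≡k (+-monoʳ-< o i<s))
    (subst (λ j → take m (drop (o + i) X) ≡ take m (drop j X)) o+s≡k
      (factor-shift X o m o+m≤ (==-sound match))))
  where
  o = k ∸ s
  m = suc (k' ∸ k)
  o+s≡k : o + s ≡ k
  o+s≡k = m∸n+n≡m s≤k
  o+m≤ : o + m ≤ suc ℓ
  o+m≤ = +-cancelˡ-≤ s (o + m) (suc ℓ) (begin
    s + (o + m)          ≡⟨ +-assoc s o m ⟨
    s + o + m            ≡⟨ cong (_+ m) (trans (+-comm s o) o+s≡k) ⟩
    k + suc (k' ∸ k)     ≡⟨ +-suc k (k' ∸ k) ⟩
    suc (k + (k' ∸ k))   ≡⟨ cong suc (m+[n∸m]≡n (<⇒≤ k<k')) ⟩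
    suc k'               ≤⟨ ≰⇒> long ⟩
    s + suc ℓ            ∎)
    where open ≤-Reasoning

breakChain-≤-ssCount : ∀ X fuel {s} k ks → BreakChain X (k ∷ ks) → s ≤ k →
  length X ≤ fuel + s → length (k ∷ ks) ≤ ssCount X fuel s
breakChain-≤-ssCount X zero {s} k ks ch s≤k enough =
  ⊥-elim (<⇒≱ (≤-<-trans s≤k (breakChain-head< X k ks ch)) enough)
breakChain-≤-ssCount X (suc fuel) {s} k ks ch s≤k enough
  rewrite dec-false (length X ≤? s) (<⇒≱ (≤-<-trans s≤k (breakChain-head< X k ks ch))) = go ks ch
  where
  s' = s + (1 ⊔ ssLen X s)
  enough' : length X ≤ fuel + s'
  enough' = ≤-trans enough (subst (_≤ fuel + s') (+-suc fuel s)
              (+-monoʳ-≤ fuel (subst (_≤ s') (+-comm s 1) (+-monoʳ-≤ s (m≤m⊔n 1 (ssLen X s))))))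
  go : ∀ ks → BreakChain X (k ∷ ks) → length (k ∷ ks) ≤ suc (ssCount X fuel s')
  go []        _ = s≤s z≤n
  go (k' ∷ ks) ch@(k<k' , new , ch') with s' ≤? k
  ... | yes s'≤k = m≤n⇒m≤1+n (breakChain-≤-ssCount X fuel k (k' ∷ ks) ch s'≤k enough')
  ... | no  _    = s≤s (breakChain-≤-ssCount X fuel k' ks ch' (ssNext-≤ X s≤k k<k' new) enough')

breakChain-≤-zSS : ∀ X ks → BreakChain X ks → length ks ≤ zSS X
breakChain-≤-zSS X []       _  = z≤n
breakChain-≤-zSS X (k ∷ ks) ch =
  breakChain-≤-ssCount X (length X) k ks ch z≤n (≤-reflexive (sym (+-identityʳ _)))

endMatch : Str → List ℕ → ℕ → ℕ → Bool
endMatch X ends s ℓ = any (λ e → (ℓ ≤ᵇ e) ∧ (take ℓ (drop (e ∸ ℓ) X) == take ℓ (drop s X))) ends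

-- A match of length j > l whose source ends at e ≤ s puts the character at l + s also at
-- l + (e ∸ j) < l + s.
endMatch⇒¬fresh : ∀ X {ends s j} l → T (endMatch X ends s j) → l < j → All (_≤ s) ends →
  ¬ Fresh X (l + s)
endMatch⇒¬fresh X {ends} {s} {j} l match l<j ends≤s fresh
  with e , e∈ , ok ← find (any⁻ _ ends match)
  with j≤ᵇe , same ← Equivalence.to T-∧ ok =
  fresh (l + (e ∸ j)) (+-monoʳ-< l (<-≤-trans (∸-monoʳ-< (≤-<-trans z≤n l<j) j≤e) (All.lookup ends≤s e∈)))
    (factor-shift X l 1 (subst (_≤ j) (+-comm 1 l) l<j) (==-sound same))
  where
  j≤e : j ≤ e
  j≤e = ≤ᵇ⇒≤ j e j≤ᵇe

endLen-fresh : ∀ X {ends s} → Fresh X s → All (_≤ s) ends → endLen X ends s ≡ 0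
endLen-fresh X {ends} {s} fresh ends≤s = maxSat-≡ (length X ∸ s) (endMatch X ends s) z≤n (inj₁ refl)
  (λ 0<j _ match → endMatch⇒¬fresh X 0 match 0<j ends≤s fresh)

endLen-copy : ∀ X {ends s l e} → e ∈ ends → l ≤ e →
  take l (drop (e ∸ l) X) ≡ take l (drop s X) → s + l ≤ length X →
  (s + l < length X → Fresh X (s + l)) → All (_≤ s) ends → endLen X ends s ≡ l
endLen-copy X {ends} {s} {l} {e} e∈ l≤e source fits fresh ends≤s =
  maxSat-≡ (length X ∸ s) (endMatch X ends s) l≤ (inj₂ match) longer
  where
  l≤ : l ≤ length X ∸ s
  l≤ = subst (_≤ length X ∸ s) (m+n∸m≡n s l) (∸-monoˡ-≤ s fits)
  match : T (endMatch X ends s l)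
  match = any⁺ _ (lose e∈ (Equivalence.from T-∧ (≤⇒≤ᵇ l≤e , ==-complete source)))
  longer : ∀ {j} → l < j → j ≤ length X ∸ s → ¬ T (endMatch X ends s j)
  longer {j} l<j j≤ m = endMatch⇒¬fresh X l m l<j ends≤s
    (subst (Fresh X) (+-comm s l) (fresh (begin-strict
      s + l              <⟨ +-monoʳ-< s l<j ⟩
      s + j              ≤⟨ +-monoʳ-≤ s j≤ ⟩
      s + (length X ∸ s) ≡⟨ m+[n∸m]≡n (≤-trans (m≤m+n s l) fits) ⟩
      length X           ∎)))
    where open ≤-Reasoning

endCount-phrase : ∀ X {fuel s ends} l → s < length X → endLen X ends s ≡ l →
  endCount X (suc fuel) s ends ≡ suc (endCount X fuel (s + (1 ⊔ l)) ((s + (1 ⊔ l)) ∷ ends))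
endCount-phrase X {s = s} l s<X refl rewrite dec-false (length X ≤? s) (<⇒≱ s<X) = refl

endCount-fresh : ∀ X {fuel s ends} → s < length X → Fresh X s → All (_≤ s) ends →
  endCount X (suc fuel) s ends ≡ suc (endCount X fuel (suc s) (suc s ∷ ends))
endCount-fresh X {fuel} {s} {ends} s<X fresh ends≤s =
  trans (endCount-phrase X {fuel} {s} {ends} 0 s<X (endLen-fresh X fresh ends≤s))
        (cong (λ t → suc (endCount X fuel t (t ∷ ends))) (+-comm s 1))

endCount-copy : ∀ X {fuel s ends l e} → s < length X → e ∈ ends → suc l ≤ e →
  take (suc l) (drop (e ∸ suc l) X) ≡ take (suc l) (drop s X) → s + suc l ≤ length X →
  (s + suc l < length X → Fresh X (s + suc l)) → All (_≤ s) ends →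
  endCount X (suc fuel) s ends ≡ suc (endCount X fuel (s + suc l) ((s + suc l) ∷ ends))
endCount-copy X {fuel} {s} {ends} {l} s<X e∈ l≤e source fits fresh ends≤s =
  endCount-phrase X {fuel} {s} {ends} (suc l) s<X (endLen-copy X e∈ l≤e source fits fresh ends≤s)

run : ℕ → ℕ → Str
run a zero    = []
run a (suc d) = a ∷ run (suc a) d

length-run : ∀ a d → length (run a d) ≡ d
length-run a zero    = refl
length-run a (suc d) = cong suc (length-run (suc a) d)

∈-run⁻ : ∀ {x} a d → x ∈ run a d → a ≤ x × x < a + d
∈-run⁻ a (suc d) (here refl) = ≤-refl , subst (a <_) (sym (+-suc a d)) (s≤s (m≤m+n a d))
∈-run⁻ {x} a (suc d) (there x∈) with ∈-run⁻ (suc a) d x∈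
... | a<x , x< = <⇒≤ a<x , subst (x <_) (sym (+-suc a d)) x<

∈-run⁺ : ∀ {x} a d → a ≤ x → x < a + d → x ∈ run a d
∈-run⁺ {x} a zero    a≤x x< = ⊥-elim (<⇒≱ x< (subst (_≤ x) (sym (+-identityʳ a)) a≤x))
∈-run⁺ {x} a (suc d) a≤x x< with a ≟ x
... | yes refl = here refl
... | no  a≢x  = there (∈-run⁺ (suc a) d (≤∧≢⇒< a≤x a≢x) (subst (x <_) (+-suc a d) x<))

∉-run-< : ∀ {x} a d → x < a → x ∉ run a d
∉-run-< a d x<a x∈ = <⇒≱ x<a (proj₁ (∈-run⁻ a d x∈))

∉-run-≥ : ∀ {x} a d → a + d ≤ x → x ∉ run a d
∉-run-≥ a d a+d≤x x∈ = <⇒≱ (proj₂ (∈-run⁻ a d x∈)) a+d≤x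

all-run-< : ∀ {N} a d → a + d ≤ N → All (_< N) (run a d)
all-run-< a d a+d≤N = All.tabulate (λ x∈ → <-≤-trans (proj₂ (∈-run⁻ a d x∈)) a+d≤N)

run-+ : ∀ a k j → run a (k + j) ≡ run a k ++ run (a + k) j
run-+ a zero    j = cong (λ b → run b j) (sym (+-identityʳ a))
run-+ a (suc k) j = cong (a ∷_) (trans (run-+ (suc a) k j) (cong (λ b → run (suc a) k ++ run b j) (sym (+-suc a k))))

run-+-++ : ∀ a k j (Y : Str) → run a (k + j) ++ Y ≡ run a k ++ (run (a + k) j ++ Y)
run-+-++ a k j Y = trans (cong (_++ Y) (run-+ a k j)) (++-assoc (run a k) (run (a + k) j) Y)

take-run-++ : ∀ a k (Y : Str) → take k (run a k ++ Y) ≡ run a k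
take-run-++ a k Y = subst (λ m → take m (run a k ++ Y) ≡ run a k) (length-run a k) (take-length-++ (run a k) Y)

drop-run-++ : ∀ a k (Y : Str) → drop k (run a k ++ Y) ≡ Y
drop-run-++ a k Y = subst (λ m → drop m (run a k ++ Y) ≡ Y) (length-run a k) (drop-length-++ (run a k) Y)

drop-suc-run-++ : ∀ a k {x} (Z : Str) → drop (suc k) (run a k ++ x ∷ Z) ≡ Z
drop-suc-run-++ a k Z =
  subst (λ m → drop (suc m) (run a k ++ _ ∷ Z) ≡ Z) (length-run a k) (drop-suc-length-++ (run a k))

take-drop-run-++ : ∀ a k d {M} (Y : Str) → k + d ≤ M → take d (drop k (run a M ++ Y)) ≡ run (a + k) d
take-drop-run-++ a k d {M} Y k+d≤M = begin
  take d (drop k (run a M ++ Y))                           ≡⟨ cong (λ m → take d (drop k (run a m ++ Y))) M≡ ⟩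
  take d (drop k (run a (k + (d + r)) ++ Y))               ≡⟨ cong (take d ∘ drop k) (run-+-++ a k (d + r) Y) ⟩
  take d (drop k (run a k ++ (run (a + k) (d + r) ++ Y)))  ≡⟨ cong (take d) (drop-run-++ a k _) ⟩
  take d (run (a + k) (d + r) ++ Y)                        ≡⟨ cong (take d) (run-+-++ (a + k) d r Y) ⟩
  take d (run (a + k) d ++ (run (a + k + d) r ++ Y))       ≡⟨ take-run-++ (a + k) d _ ⟩
  run (a + k) d                                            ∎
  where
  open ≡-Reasoning
  r = M ∸ (k + d)
  M≡ : M ≡ k + (d + r)
  M≡ = trans (sym (m+[n∸m]≡n k+d≤M)) (+-assoc k d r)

blocks : ℕ → List (ℕ × ℕ) → Str
blocks N []             = []
blocks N ((a , d) ∷ bs) = N ∷ run a d ++ blocks (suc N) bs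

length-blocks-≤ : ∀ N bs {B} → All ((_≤ B) ∘ proj₂) bs → length (blocks N bs) ≤ length bs * suc B
length-blocks-≤ N []             []           = z≤n
length-blocks-≤ N ((a , d) ∷ bs) (d≤B ∷ bs≤) = s≤s (begin
  length (run a d ++ blocks (suc N) bs)          ≡⟨ length-++ (run a d) ⟩
  length (run a d) + length (blocks (suc N) bs)  ≡⟨ cong (_+ _) (length-run a d) ⟩
  d + length (blocks (suc N) bs)                 ≤⟨ +-mono-≤ d≤B (length-blocks-≤ (suc N) bs bs≤) ⟩
  _ + length bs * suc _                          ∎)
  where open ≤-Reasoning

∉-all-< : ∀ {N} {P : Str} → All (_< N) P → N ∉ P
∉-all-< P<N N∈P = <-irrefl refl (All.lookup P<N N∈P)

blocks-fresh : ∀ (P : Str) {N} bs → All (_< N) P → length P < length (P ++ blocks N bs) →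
  Fresh (P ++ blocks N bs) (length P)
blocks-fresh P []      P<N P<  = ⊥-elim (<-irrefl (sym (cong length (++-identityʳ P))) P<)
blocks-fresh P (_ ∷ _) P<N _   = fresh-++ P (∉-all-< P<N)

length-++-run : ∀ (P : Str) N a d → length (P ++ N ∷ run a d) ≡ suc (length P + d)
length-++-run P N a d = trans (length-++ P) (trans (cong (λ k → length P + suc k) (length-run a d)) (+-suc (length P) d))

all-<-++-run : ∀ {N} {P : Str} a d → All (_< N) P → a + d ≤ N → All (_< suc N) (P ++ N ∷ run a d)
all-<-++-run a d P<N a+d≤N = ++⁺ (All.map m≤n⇒m≤1+n P<N) (≤-refl ∷ all-run-< a d (m≤n⇒m≤1+n a+d≤N))

-- run a d is a nonempty factor of run 1 L
BlockIn : ℕ → ℕ × ℕ → Set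
BlockIn L (a , d) = 1 ≤ a × a + d ≤ suc L × 1 ≤ d

EndsCover : ℕ → List ℕ → Set
EndsCover L ends = ∀ {v} → 1 ≤ v → v ≤ L → v ∈ ends

module _ (L : ℕ) (Y : Str) where

  private
    X : Str
    X = run 1 L ++ Y

  endCount-blocks : ∀ fuel bs (P : Str) N {ends} → X ≡ P ++ blocks N bs → All (_< N) P → L < N →
    All (_≤ length P) ends → EndsCover L ends → All (BlockIn L) bs →
    endCount X fuel (length P) ends ≤ length bs * 2
  endCount-blocks zero bs P N _ _ _ _ _ _ = z≤n
  endCount-blocks (suc fuel) [] P N X≡ _ _ _ _ _
    rewrite dec-true (length X ≤? length P) (≤-reflexive (trans (cong length X≡) (cong length (++-identityʳ P))))
    = z≤n
  endCount-blocks (suc fuel) ((suc a' , suc d') ∷ bs) P N {ends} X≡ P<N L<N ends≤ cover ((_ , a+d≤ , _) ∷ ok) =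
    ≤-trans (≤-reflexive (endCount-fresh X {fuel} s<X separator ends≤)) (s≤s (copy fuel))
    where
    a = suc a'
    d = suc d'
    s = length P
    Z = blocks (suc N) bs
    P' = P ++ N ∷ run a d
    X≡' : X ≡ P' ++ Z
    X≡' = trans X≡ (sym (++-assoc P (N ∷ run a d) Z))
    lenP' : length P' ≡ suc s + d
    lenP' = length-++-run P N a d
    lenX : length X ≡ (suc s + d) + length Z
    lenX = trans (cong length X≡') (trans (length-++ P') (cong (_+ length Z) lenP'))
    fits : suc s + d ≤ length X
    fits = subst (suc s + d ≤_) (sym lenX) (m≤m+n _ _)
    s1<X : suc s < length X
    s1<X = <-≤-trans (m<m+n (suc s) (s≤s z≤n)) fits
    s<X : s < length X
    s<X = <-trans ≤-refl s1<X
    separator : Fresh X s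
    separator = subst (λ W → Fresh W s) (sym X≡) (fresh-++ P (∉-all-< P<N))
    P'<N : All (_< suc N) P'
    P'<N = all-<-++-run a d P<N (≤-trans a+d≤ L<N)
    nextSeparator : suc s + d < length X → Fresh X (suc s + d)
    nextSeparator lt = subst₂ Fresh (sym X≡') lenP'
      (blocks-fresh P' bs P'<N (subst₂ _<_ (sym lenP') (cong length X≡') lt))
    source : take d (drop (a' + d ∸ d) X) ≡ take d (drop (suc s) X)
    source = begin
      take d (drop (a' + d ∸ d) X)  ≡⟨ cong (λ k → take d (drop k X)) (m+n∸n≡m a' d) ⟩
      take d (drop a' X)            ≡⟨ take-drop-run-++ 1 a' d Y (≤-pred a+d≤) ⟩
      run a d                       ≡⟨ take-run-++ a d Z ⟨
      take d (run a d ++ Z)         ≡⟨ cong (take d) (trans (cong (drop (suc s)) X≡) (drop-suc-length-++ P)) ⟨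
      take d (drop (suc s) X)       ∎
      where open ≡-Reasoning
    ends₁≤ : All (_≤ suc s) (suc s ∷ ends)
    ends₁≤ = ≤-refl ∷ All.map m≤n⇒m≤1+n ends≤
    copy : ∀ f → endCount X f (suc s) (suc s ∷ ends) ≤ suc (length bs * 2)
    copy zero    = z≤n
    copy (suc f) = ≤-trans
      (≤-reflexive (endCount-copy X {f} {suc s} {suc s ∷ ends} s1<X
        (there (cover (≤-trans (s≤s z≤n) (m≤n+m d a')) (≤-pred a+d≤))) (m≤n+m d a') source fits nextSeparator ends₁≤))
      (s≤s (subst (λ t → endCount X f t (t ∷ suc s ∷ ends) ≤ length bs * 2) lenP'
        (endCount-blocks f bs P' (suc N) X≡' P'<N (m≤n⇒m≤1+n L<N)
          (≤-refl ∷ All.map (λ e≤ → ≤-trans e≤ (subst (suc s ≤_) (sym lenP') (m≤m+n (suc s) d)))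
                              ends₁≤)
          (λ 1≤v v≤L → there (there (cover 1≤v v≤L))) ok)))

  endCount-prefix : ∀ N bs → Y ≡ blocks N bs → L < N → All (BlockIn L) bs →
    ∀ j fuel {s ends} → s + j ≡ L → All (_≤ s) ends → EndsCover s ends →
    endCount X fuel s ends ≤ j + length bs * 2
  endCount-prefix N bs Y≡ L<N ok zero fuel {s} {ends} s+0≡L ends≤ cover =
    subst (λ t → endCount X fuel t ends ≤ length bs * 2) P≡s
      (endCount-blocks fuel bs (run 1 L) N (cong (run 1 L ++_) Y≡) (all-run-< 1 L L<N) L<N
        (subst (λ t → All (_≤ t) ends) (sym P≡s) ends≤) (subst (λ t → EndsCover t ends) s≡L cover) ok)
    where
    s≡L : s ≡ L
    s≡L = trans (sym (+-identityʳ s)) s+0≡L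
    P≡s : length (run 1 L) ≡ s
    P≡s = trans (length-run 1 L) (sym s≡L)
  endCount-prefix N bs Y≡ L<N ok (suc j) zero _ _ _ = z≤n
  endCount-prefix N bs Y≡ L<N ok (suc j) (suc fuel) {s} {ends} s+j≡L ends≤ cover =
    ≤-trans (≤-reflexive (endCount-fresh X {fuel} s<X fresh ends≤))
      (s≤s (endCount-prefix N bs Y≡ L<N ok j fuel (trans (sym (+-suc s j)) s+j≡L)
        (≤-refl ∷ All.map m≤n⇒m≤1+n ends≤) cover'))
    where
    X≡ : X ≡ run 1 s ++ suc s ∷ (run (suc (suc s)) j ++ Y)
    X≡ = trans (cong (λ k → run 1 k ++ Y) (sym s+j≡L)) (run-+-++ 1 s (suc j) Y)
    fresh : Fresh X s
    fresh = subst₂ Fresh (sym X≡) (length-run 1 s) (fresh-++ (run 1 s) (∉-run-≥ 1 s ≤-refl))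
    s<X : s < length X
    s<X = begin-strict
      s                     <⟨ m<m+n s (s≤s z≤n) ⟩
      s + suc j             ≡⟨ s+j≡L ⟩
      L                     ≡⟨ length-run 1 L ⟨
      length (run 1 L)      ≤⟨ m≤m+n _ _ ⟩
      length (run 1 L) + length Y ≡⟨ length-++ (run 1 L) ⟨
      length X              ∎
      where open ≤-Reasoning
    cover' : EndsCover (suc s) (suc s ∷ ends)
    cover' {v} 1≤v v≤1+s with v ≟ suc s
    ... | yes refl = here refl
    ... | no  v≢   = there (cover 1≤v (≤-pred (≤∧≢⇒< v≤1+s v≢)))

  zEnd-≤ : ∀ N bs → Y ≡ blocks N bs → L < N → All (BlockIn L) bs → zEnd X ≤ L + length bs * 2
  zEnd-≤ N bs Y≡ L<N ok =
    endCount-prefix N bs Y≡ L<N ok L (length X) refl [] (λ 1≤v v≤0 → ⊥-elim (<⇒≱ 1≤v v≤0))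

NotFactor : Str → Str → Set
NotFactor w P = ∀ i → ¬ Occ w P i

Subrun : ℕ × ℕ → ℕ × ℕ → Set
Subrun (a' , d') (a , d) = a ≤ a' × a' + d' ≤ a + d

occ-run⇒subrun : ∀ {a' d' a d j} → Occ (run a' (suc d')) (run a d) j → Subrun (a' , suc d') (a , d)
occ-run⇒subrun {a'} {d'} {a} {d} occ =
  proj₁ (∈-run⁻ a d (occ-∈ (here refl) occ)) ,
  subst (_≤ a + d) (sym (+-suc a' d'))
    (proj₂ (∈-run⁻ a d (occ-∈ (∈-run⁺ a' (suc d') (m≤m+n a' d') (+-monoʳ-< a' ≤-refl)) occ)))

Admissible : ℕ → Str → ℕ × ℕ → Set
Admissible N P (a , d) = 2 ≤ d × a + d ≤ N × NotFactor (run a d) P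

admissible-++ : ∀ {N P a d} b' → Admissible N P b' → ¬ Subrun b' (a , d) →
  Admissible (suc N) (P ++ N ∷ run a d) b'
admissible-++ {N} {P} {a} {d} (a' , suc d') (2≤d , a+d≤N , absent) notSub =
  2≤d , m≤n⇒m≤1+n a+d≤N , λ i occ →
    [ absent i , notSub ∘ occ-run⇒subrun ∘ proj₂ ]′
      (occ-++-sep P (∉-run-≥ a' (suc d') a+d≤N) occ)

-- the separator before each run, the run's first and its last character
chainPositions : ℕ → List (ℕ × ℕ) → List ℕ
chainPositions q []             = []
chainPositions q ((a , d) ∷ bs) = q ∷ suc q ∷ q + d ∷ chainPositions (suc (q + d)) bs

length-chainPositions : ∀ q bs → length (chainPositions q bs) ≡ length bs * 3
length-chainPositions q []             = refl
length-chainPositions q ((a , d) ∷ bs) = cong (3 +_) (length-chainPositions (suc (q + d)) bs)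

fresh⇒noEarlierOcc-succ : ∀ X {k} o → o < 2 → Fresh X (o + k) → NoEarlierOcc X k (suc (suc k ∸ k))
fresh⇒noEarlierOcc-succ X {k} o o<2 fresh =
  subst (λ m → NoEarlierOcc X k (suc m)) (sym (m+n∸n≡m 1 k)) (fresh⇒noEarlierOcc X o o<2 fresh)

blocks-breakChain : ∀ bs (P : Str) N {X} → X ≡ P ++ blocks N bs → All (_< N) P →
  All (Admissible N P) bs → AllPairs (λ b b' → ¬ Subrun b' b) bs →
  BreakChain X (chainPositions (length P) bs)
blocks-breakChain [] P N X≡ P<N [] [] = tt
blocks-breakChain ((_ , suc zero) ∷ _) _ _ _ _ ((s≤s () , _) ∷ _) _
blocks-breakChain ((a , suc (suc d'')) ∷ bs) P N {X} X≡ P<N ((_ , a+d≤N , absent) ∷ adm) (notSub ∷ pairs) =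
  n<1+n q , fresh⇒noEarlierOcc-succ X 0 (s≤s z≤n) separator ,
  subst (_< q + d) (+-comm q 1) (+-monoʳ-< q (s≤s (s≤s z≤n))) , runNew ,
  last bs X≡' (subst (λ t → BreakChain X (chainPositions t bs)) lenP'
    (blocks-breakChain bs P' (suc N) X≡' P'<N (All.zipWith (uncurry (admissible-++ _)) (adm , notSub)) pairs))
  where
  d = suc (suc d'')
  q = length P
  Z = blocks (suc N) bs
  P' = P ++ N ∷ run a d
  X≡' : X ≡ P' ++ Z
  X≡' = trans X≡ (sym (++-assoc P (N ∷ run a d) Z))
  lenP' : length P' ≡ suc (q + d)
  lenP' = length-++-run P N a d
  P'<N : All (_< suc N) P'
  P'<N = all-<-++-run a d P<N a+d≤N
  separator : Fresh X q
  separator = subst (λ W → Fresh W q) (sym X≡) (fresh-++ P (∉-all-< P<N))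
  runNew : NoEarlierOcc X (suc q) (suc (q + d ∸ suc q))
  runNew i i<1+q eq with occ-++-sep P (∉-run-≥ a d a+d≤N) (subst (λ W → Occ (run a d) W i) X≡ occ)
    where
    occ : Occ (run a d) X i
    occ = occurs (subst (λ m → take m (drop i X) ≡ run a d) (sym (length-run a d)) (begin
      take d (drop i X)          ≡⟨ subst (λ m → take (suc m) (drop i X) ≡ take (suc m) (drop (suc q) X))
                                      (trans (cong (_∸ suc q) (+-suc q (suc d''))) (m+n∸m≡n q (suc d''))) eq ⟩
      take d (drop (suc q) X)    ≡⟨ cong (take d) (trans (cong (drop (suc q)) X≡) (drop-suc-length-++ P)) ⟩
      take d (run a d ++ Z)      ≡⟨ take-run-++ a d Z ⟩
      run a d                    ∎))
      where open ≡-Reasoning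
  ... | inj₁ occ         = absent i occ
  ... | inj₂ (q<i , _)   = <⇒≱ q<i (≤-pred i<1+q)
  last : ∀ bs' → X ≡ P' ++ blocks (suc N) bs' → BreakChain X (chainPositions (suc (q + d)) bs') →
    BreakChain X (q + d ∷ chainPositions (suc (q + d)) bs')
  last []      X≡'' _  =
    subst (q + d <_) (sym (trans (cong length X≡'') (trans (cong length (++-identityʳ P')) lenP'))) ≤-refl
  last (_ ∷ _) X≡'' ch = n<1+n (q + d) ,
    fresh⇒noEarlierOcc-succ X 1 ≤-refl (subst₂ Fresh (sym X≡'') lenP' (fresh-++ P' (∉-all-< P'<N))) , ch

longer-¬subrun : ∀ {a d a' d'} → d < d' → ¬ Subrun (a' , d') (a , d)
longer-¬subrun {a} {d} {a'} {d'} d<d' (a≤a' , a'+d'≤) = <⇒≱ (+-mono-≤-< a≤a' d<d') a'+d'≤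

shifted-¬subrun : ∀ {a d a'} → a < a' → ¬ Subrun (a' , d) (a , d)
shifted-¬subrun {a} {d} {a'} a<a' (_ , a'+d≤) = <⇒≱ a<a' (+-cancelʳ-≤ d a' a a'+d≤)

row : ℕ → ℕ → ℕ → List (ℕ × ℕ)
row d a zero    = []
row d a (suc k) = (a , d) ∷ row d (suc a) k

rows : ℕ → ℕ → ℕ → List (ℕ × ℕ)
rows D d zero    = []
rows D d (suc k) = row d 1 D ++ rows D (suc d) k

length-rows : ∀ D d k → length (rows D d k) ≡ k * D
length-rows D d zero    = refl
length-rows D d (suc k) = trans (length-++ (row d 1 D)) (cong₂ _+_ (length-row d 1 D) (length-rows D (suc d) k))
  where
  length-row : ∀ d a k → length (row d a k) ≡ k
  length-row d a zero    = refl
  length-row d a (suc k) = cong suc (length-row d (suc a) k)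

row-bounds : ∀ d a k → All (λ b → proj₂ b ≡ d × a ≤ proj₁ b × proj₁ b < a + k) (row d a k)
row-bounds d a zero    = []
row-bounds d a (suc k) = (refl , ≤-refl , m<m+n a (s≤s z≤n)) ∷
  All.map (λ (b₂≡d , a<b₁ , b₁<) → b₂≡d , <⇒≤ a<b₁ , <-≤-trans b₁< (≤-reflexive (sym (+-suc a k))))
    (row-bounds d (suc a) k)

rows-bounds : ∀ D d k →
  All (λ b → 1 ≤ proj₁ b × proj₁ b ≤ D × d ≤ proj₂ b × proj₂ b < d + k) (rows D d k)
rows-bounds D d zero    = []
rows-bounds D d (suc k) = ++⁺
  (All.map (λ (b₂≡d , 1≤b₁ , b₁<) → 1≤b₁ , ≤-pred b₁< , ≤-reflexive (sym b₂≡d) ,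
              subst (_< d + suc k) (sym b₂≡d) (m<m+n d (s≤s z≤n))) (row-bounds d 1 D))
  (All.map (λ (1≤b₁ , b₁≤D , d<b₂ , b₂<) →
              1≤b₁ , b₁≤D , <⇒≤ d<b₂ , <-≤-trans b₂< (≤-reflexive (sym (+-suc d k))))
    (rows-bounds D (suc d) k))

-- later blocks are never subruns of earlier ones: they are longer, or equally long and further right
rows-pairs : ∀ D d k → AllPairs (λ b b' → ¬ Subrun b' b) (rows D d k)
rows-pairs D d zero    = []
rows-pairs D d (suc k) = AllPairs.++⁺ (row-pairs 1 D) (rows-pairs D (suc d) k)
  (All.map (λ (b₂≡d , _) →
              All.map (λ (_ , _ , d<b₂' , _) → longer-¬subrun (subst (_< _) (sym b₂≡d) d<b₂'))
                (rows-bounds D (suc d) k))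
    (row-bounds d 1 D))
  where
  row-pairs : ∀ a k → AllPairs (λ b b' → ¬ Subrun b' b) (row d a k)
  row-pairs a zero    = []
  row-pairs a (suc k) =
    All.map (λ (b₂≡d , a<b₁ , _) →
               subst (λ d' → ¬ Subrun (_ , d') (a , d)) (sym b₂≡d) (shifted-¬subrun a<b₁))
      (row-bounds d (suc a) k) ∷ row-pairs (suc a) k

-- D = 6 + E: the text has length at most 6D³ and the edit creates at least D(D − 3) phrases,
-- so n² ≤ 36D⁶ ≤ (4D²)³ ≤ (8D(D − 3))³
power-bound : ∀ E {n x y} →
  n ≤ 3 * (6 + E) + (6 + E) * (6 + E) * suc (2 * (6 + E)) →
  x ≤ 3 * (6 + E) + (6 + E) * (6 + E) * 2 →
  (6 + E) * (6 + E) * 3 ≤ y →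
  n ^ 2 ≤ (8 * (y ∸ x)) ^ 3
power-bound E {n} {x} {y} n≤ x≤ y≥ = begin
  n ^ 2                                                 ≤⟨ ^-monoˡ-≤ 2 n≤6D³ ⟩
  (6 * (D * D * D)) ^ 2                                 ≤⟨ m≤m+n _ _ ⟩
  (6 * (D * D * D)) ^ 2 + 28 * (D * D * D * D * D * D)  ≡⟨ sixth-powers D ⟨
  (4 * (D * D)) ^ 3                                     ≤⟨ ^-monoˡ-≤ 3 4D²≤8gap ⟩
  (8 * (y ∸ x)) ^ 3                                     ∎
  where
  open ≤-Reasoning
  D = 6 + E
  slack : ∀ {a b} c → b ≡ a + c → a ≤ b
  slack {a} c b≡ = subst (a ≤_) (sym b≡) (m≤m+n a c)
  length-slack : ∀ E → 6 * ((6 + E) * (6 + E) * (6 + E)) ≡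
    (3 * (6 + E) + (6 + E) * (6 + E) * suc (2 * (6 + E))) + (6 + E) * (27 + 4 * E) * (5 + E)
  length-slack = solve-∀
  sixth-powers : ∀ x → let z = 4 * (x * x) ; w = 6 * (x * x * x) in
    z * (z * (z * 1)) ≡ w * (w * 1) + 28 * (x * x * x * x * x * x)
  sixth-powers = solve-∀
  gap-split : ∀ E → (6 + E) * (6 + E) * 3 ≡ (3 * (6 + E) + (6 + E) * (6 + E) * 2) + (3 + E) * (6 + E)
  gap-split = solve-∀
  gap-double : ∀ E → 8 * ((3 + E) * (6 + E)) ≡ 4 * ((6 + E) * (6 + E)) + 4 * (E * (6 + E))
  gap-double = solve-∀
  n≤6D³ : n ≤ 6 * (D * D * D)
  n≤6D³ = ≤-trans n≤ (slack ((6 + E) * (27 + 4 * E) * (5 + E)) (length-slack E))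
  gap : (3 + E) * D ≤ y ∸ x
  gap = subst (_≤ y ∸ x) (trans (cong (_∸ L+2D²) (gap-split E)) (m+n∸m≡n L+2D² ((3 + E) * D)))
          (∸-mono y≥ x≤)
    where L+2D² = 3 * D + D * D * 2
  4D²≤8gap : 4 * (D * D) ≤ 8 * (y ∸ x)
  4D²≤8gap = ≤-trans (slack (4 * (E * D)) (gap-double E)) (*-monoʳ-≤ 8 gap)

++-∷-≢[] : ∀ (S : Str) {x W} → S ++ x ∷ W ≢ []
++-∷-≢[] []      ()
++-∷-≢[] (_ ∷ _) ()

module HardInstance (D' : ℕ) where

  D L : ℕ
  D = suc D'
  L = 3 * D

  family : List (ℕ × ℕ)
  family = rows D (suc D) D

  suffix text : Str
  suffix = blocks (suc L) family
  text = run 1 L ++ suffix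

  family-bounds : All (λ b → 1 ≤ proj₁ b × proj₁ b ≤ D × suc D ≤ proj₂ b × proj₂ b < suc D + D) family
  family-bounds = rows-bounds D (suc D) D

  length-family : length family ≡ D * D
  length-family = length-rows D (suc D) D

  d≤2D : ∀ {d} → d < suc D + D → d ≤ 2 * D
  d≤2D {d} d< = subst (d ≤_) (cong (D +_) (sym (+-identityʳ D))) (≤-pred d<)

  length-text : length text ≡ L + length suffix
  length-text = trans (length-++ (run 1 L)) (cong (_+ length suffix) (length-run 1 L))

  length-text-≤ : length text ≤ L + D * D * suc (2 * D)
  length-text-≤ = subst (_≤ L + D * D * suc (2 * D)) (sym length-text) (+-monoʳ-≤ L
    (subst (λ k → length suffix ≤ k * suc (2 * D)) length-family
      (length-blocks-≤ (suc L) family (All.map (λ (_ , _ , _ , d<) → d≤2D d<) family-bounds))))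

  zEnd-text : zEnd text ≤ L + D * D * 2
  zEnd-text = subst (λ k → zEnd text ≤ L + k * 2) length-family
    (zEnd-≤ L suffix (suc L) family refl ≤-refl
      (All.map (λ (1≤a , a≤D , D<d , d<) →
                  1≤a , m≤n⇒m≤1+n (+-mono-≤ a≤D (d≤2D d<)) , ≤-trans (s≤s z≤n) D<d)
        family-bounds))

  zSS-edited : ∀ S → All (_< suc L) S → All (λ b → NotFactor (uncurry run b) S) family →
    D * D * 3 ≤ zSS (S ++ suffix)
  zSS-edited S S<N absent = subst (_≤ zSS (S ++ suffix))
    (trans (length-chainPositions (length S) family) (cong (_* 3) length-family))
    (breakChain-≤-zSS _ _ (blocks-breakChain family S (suc L) refl S<N
      (All.zipWith (λ ((_ , a≤D , D<d , d<) , absent-b) →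
          ≤-trans (s≤s (s≤s z≤n)) D<d , m≤n⇒m≤1+n (+-mono-≤ a≤D (d≤2D d<)) , absent-b)
        (family-bounds , absent))
      (rows-pairs D (suc D) D)))

  family-runs : All (λ b → D ∈ uncurry run b × suc D ∈ uncurry run b × 0 ∉ uncurry run b) family
  family-runs = All.map (λ { {a , d} (1≤a , a≤D , D<d , _) →
      ∈-run⁺ a d a≤D (≤-trans D<d (m≤n+m d a)) ,
      ∈-run⁺ a d (m≤n⇒m≤1+n a≤D) (+-mono-≤ 1≤a D<d) ,
      ∉-run-< a d 1≤a })
    family-bounds

  afterD : Str
  afterD = run (suc D) (2 * D) ++ suffix

  text-split-D' : text ≡ run 1 D' ++ D ∷ afterD
  text-split-D' = trans (cong (λ k → run 1 k ++ suffix) (sym (+-suc D' (2 * D))))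
                        (run-+-++ 1 D' (suc (2 * D)) suffix)

  text-split-D : text ≡ run 1 D ++ afterD
  text-split-D = run-+-++ 1 D (2 * D) suffix

  D≤length-text : D ≤ length text
  D≤length-text = ≤-trans (m≤m+n D (2 * D)) (subst (L ≤_) (sym length-text) (m≤m+n L (length suffix)))

  initial-< : ∀ {k} → k ≤ D → All (_< suc L) (run 1 k)
  initial-< k≤D = all-run-< 1 _ (s≤s (≤-trans k≤D (m≤m+n D (2 * D))))

  upper-< : All (_< suc L) (run (suc D) (2 * D))
  upper-< = all-run-< (suc D) (2 * D) ≤-refl

  D∉upper : D ∉ run (suc D) (2 * D)
  D∉upper = ∉-run-< (suc D) (2 * D) ≤-refl

  EditedText : EditType → Set
  EditedText e = ∃[ S ] (Edit e text (S ++ suffix) × All (_< suc L) S ×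
                         All (λ b → NotFactor (uncurry run b) S) family)

  edited : ∀ e → EditedText e
  edited sub = run 1 D' ++ 0 ∷ run (suc D) (2 * D) ,
    subst (Edit sub text) text≡ (esub D' 0 D≤length-text) ,
    ++⁺ (initial-< (n≤1+n D')) (s≤s z≤n ∷ upper-<) ,
    All.map (λ (D∈ , _ , 0∉) i occ →
        [ ∉-run-≥ 1 D' ≤-refl ∘ occ-∈ D∈ , D∉upper ∘ occ-∈ D∈ ∘ proj₂ ]′
          (occ-++-sep (run 1 D') 0∉ occ))
      family-runs
    where
    open ≡-Reasoning
    text≡ : take D' text ++ 0 ∷ drop (suc D') text ≡ (run 1 D' ++ 0 ∷ run (suc D) (2 * D)) ++ suffix
    text≡ = begin
      take D' text ++ 0 ∷ drop (suc D') text
        ≡⟨ cong (λ T → take D' T ++ 0 ∷ drop (suc D') T) text-split-D' ⟩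
      take D' (run 1 D' ++ D ∷ afterD) ++ 0 ∷ drop (suc D') (run 1 D' ++ D ∷ afterD)
        ≡⟨ cong₂ (λ P Q → P ++ 0 ∷ Q) (take-run-++ 1 D' (D ∷ afterD)) (drop-suc-run-++ 1 D' afterD) ⟩
      run 1 D' ++ 0 ∷ afterD
        ≡⟨ ++-assoc (run 1 D') (0 ∷ run (suc D) (2 * D)) suffix ⟨
      (run 1 D' ++ 0 ∷ run (suc D) (2 * D)) ++ suffix ∎
  edited ins = run 1 D ++ 0 ∷ run (suc D) (2 * D) ,
    subst (Edit ins text) text≡ (eins D 0 D≤length-text) ,
    ++⁺ (initial-< ≤-refl) (s≤s z≤n ∷ upper-<) ,
    All.map (λ (D∈ , D+1∈ , 0∉) i occ →
        [ ∉-run-≥ 1 D ≤-refl ∘ occ-∈ D+1∈ , D∉upper ∘ occ-∈ D∈ ∘ proj₂ ]′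
          (occ-++-sep (run 1 D) 0∉ occ))
      family-runs
    where
    open ≡-Reasoning
    text≡ : take D text ++ 0 ∷ drop D text ≡ (run 1 D ++ 0 ∷ run (suc D) (2 * D)) ++ suffix
    text≡ = begin
      take D text ++ 0 ∷ drop D text
        ≡⟨ cong (λ T → take D T ++ 0 ∷ drop D T) text-split-D ⟩
      take D (run 1 D ++ afterD) ++ 0 ∷ drop D (run 1 D ++ afterD)
        ≡⟨ cong₂ (λ P Q → P ++ 0 ∷ Q) (take-run-++ 1 D afterD) (drop-run-++ 1 D afterD) ⟩
      run 1 D ++ 0 ∷ afterD
        ≡⟨ ++-assoc (run 1 D) (0 ∷ run (suc D) (2 * D)) suffix ⟨
      (run 1 D ++ 0 ∷ run (suc D) (2 * D)) ++ suffix ∎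
  edited del = run 1 D' ++ run (suc D) (2 * D) ,
    subst (Edit del text) text≡ (edel D' D≤length-text) ,
    ++⁺ (initial-< (n≤1+n D')) upper-< ,
    All.map (λ (D∈ , _ , _) i occ →
        [ ∉-run-≥ 1 D' ≤-refl , D∉upper ]′ (∈-++⁻ (run 1 D') (occ-∈ D∈ occ)))
      family-runs
    where
    open ≡-Reasoning
    text≡ : take D' text ++ drop (suc D') text ≡ (run 1 D' ++ run (suc D) (2 * D)) ++ suffix
    text≡ = begin
      take D' text ++ drop (suc D') text
        ≡⟨ cong (λ T → take D' T ++ drop (suc D') T) text-split-D' ⟩
      take D' (run 1 D' ++ D ∷ afterD) ++ drop (suc D') (run 1 D' ++ D ∷ afterD)
        ≡⟨ cong₂ _++_ (take-run-++ 1 D' (D ∷ afterD)) (drop-suc-run-++ 1 D' afterD) ⟩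
      run 1 D' ++ afterD
        ≡⟨ ++-assoc (run 1 D') (run (suc D) (2 * D)) suffix ⟨
      (run 1 D' ++ run (suc D) (2 * D)) ++ suffix ∎

theorem5 : (c : Str → ℕ) →
    (∀ T → T ≢ [] → 1 ≤ c T) →
    (∀ T → T ≢ [] → zSS T ≤ c T) →
    (∀ T → T ≢ [] → c T ≤ zEnd T) →
    (e : EditType) →
    ∃[ k ] (1 ≤ k × (∀ m → ∃[ n ] (m ≤ n × ∃[ T ] ∃[ T' ]
    (length T ≡ n × T ≢ [] × T' ≢ [] × Edit e T T' × n ^ 2 ≤ (k * (c T' ∸ c T)) ^ 3))))
theorem5 c _ zSS≤c c≤zEnd e = 8 , s≤s z≤n , λ m →
  let open HardInstance (5 + m)
      (S , edit , S<N , absent) = edited e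
  in length text , ≤-trans (m≤n+m m 6) D≤length-text , text , S ++ suffix ,
     refl , (λ ()) , ++-∷-≢[] S , edit ,
     power-bound m length-text-≤
       (≤-trans (c≤zEnd text (λ ())) zEnd-text)
       (≤-trans (zSS-edited S S<N absent) (zSS≤c (S ++ suffix) (++-∷-≢[] S)))
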